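{- Every un2qBMG is $P_6$-free and $C_6$-free; i.e., the underlying undirected graph of any 2qBMG contains no induced subgraph isomorphic to the path $P_6$ on six vertices and none isomorphic to the cycle $C_6$ on six vertices.
   Context: A rooted phylogenetic tree $T$ is a rooted tree with root $\rho$ in which every non-leaf vertex has at least two children; $L=L(T)$ denotes its leaf set. Write $v\preceq_T u$ if $u$ lies on the path from $\rho$ to $v$, and $\mathrm{lca}_T(x,y)$ for the $\preceq_T$-smallest common ancestor of $x,y$. Let $\sigma\colon L\to S$ be a leaf coloring, where $S$ is a set of two colors. For leaves $x,y$ with $\sigma(x)\neq\sigma(y)$, $y$ is a best match of $x$ if $\mathrm{lca}_T(x,y)\preceq_T\mathrm{lca}_T(x,y')$ for all leaves $y'$ with $\sigma(y')=\sigma(y)$. A truncation map $u_T\colon L\times S\to V(T)$ assigns to each leaf $x$ and color $s$ a vertex on the path from $\rho$ to $x$, with $u_T(x,\sigma(x))=x$. A leaf $y$ is a quasi-best match of $x$ if $y$ is a best match of $x$ and $\mathrm{lca}_T(x,y)\preceq_T u_T(x,\sigma(y))$. The quasi-best match graph of $(T,\sigma,u_T)$ is the vertex-colored digraph on $L$ (colored by $\sigma$) with an arc $xy$ iff $y$ is a quasi-best match of $x$. A 2qBMG is a vertex-colored digraph with two colors that arises in this way. (Known equivalent characterization: a digraph with a proper 2-coloring is a 2qBMG iff (N1) there are no four distinct vertices $u,t,w,v$ with $u,v$ non-adjacent and $ut, vw, tw$ arcs; (N2) whenever $uv,vw,wt$ are arcs, $ut$ is an arc; (N3) for distinct $u,v$,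 if $N^+(u)\cap N^+(v)\neq\emptyset$ then $N^+(u)\subseteq N^+(v)$ or $N^+(v)\subseteq N^+(u)$, $N^+$ denoting out-neighbourhood.) The underlying undirected graph of a digraph has the same vertex set and an edge $uv$ whenever $uv$ or $vu$ is an arc. An un2qBMG is the underlying undirected graph of some 2qBMG. $P_n$ is the path graph on $n$ vertices and $C_n$ the cycle graph on $n$ vertices; a graph is $H$-free if it has no induced subgraph isomorphic to $H$. -}

module Defs where

open import Data.Nat using (ℕ; zero; suc)
open import Data.Fin using (Fin; toℕ)
open import Data.Bool using (Bool)
open import Data.Product using (Σ; ∃; ∃-syntax; _×_; _,_)
open import Data.Sum using (_⊎_)
open import Relation.Nullary using (¬_)
open import Relation.Binary.PropositionalEquality using (_≡_; _≢_)
open import Function using (Injective)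
open import Function.Bundles using (_⇔_)

iter : ∀ {A : Set} → (A → A) → ℕ → A → A
iter f zero    a = a
iter f (suc k) a = f (iter f k a)

record RootedTree (m : ℕ) : Set where
  field
    root   : Fin m
    parent : Fin m → Fin m
    rootParent : parent root ≡ root
    reachRoot  : ∀ v → ∃[ k ] iter parent k v ≡ root

  Child : Fin m → Fin m → Set
  Child w v = parent w ≡ v × w ≢ v

  _⪯_ : Fin m → Fin m → Set
  v ⪯ u = ∃[ k ] iter parent k v ≡ u

  IsLeaf : Fin m → Set
  IsLeaf v = ∀ w → ¬ Child w v

  IsLca : Fin m → Fin m → Fin m → Set
  IsLca x y w = (x ⪯ w × y ⪯ w) × (∀ w' → x ⪯ w' → y ⪯ w' → w ⪯ w')

IsPhylogenetic : ∀ {m} → RootedTree m → Set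
IsPhylogenetic {m} T = ∀ v → (∃[ w ] Child w v) →
    ∃[ w₁ ] ∃[ w₂ ] (w₁ ≢ w₂ × Child w₁ v × Child w₂ v)
  where open RootedTree T

record PhyloTree (n : ℕ) : Set where
  field
    m       : ℕ
    tree    : RootedTree m
    phylo   : IsPhylogenetic tree
    leaf    : Fin n → Fin m
    leafInj : Injective _≡_ _≡_ leaf
    leafIsLeaf : ∀ x → RootedTree.IsLeaf tree (leaf x)
    leafOnto   : ∀ v → RootedTree.IsLeaf tree v → ∃[ x ] leaf x ≡ v

-- Colours: the two-element set S = Bool.
Colouring : ℕ → Set
Colouring n = Fin n → Bool

module _ {n : ℕ} (P : PhyloTree n) (σ : Colouring n) where
  open PhyloTree P
  open RootedTree tree

  BestMatch : Fin n → Fin n → Set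
  BestMatch x y = σ x ≢ σ y ×
    (∀ y' w w' → σ y' ≡ σ y → IsLca (leaf x) (leaf y) w →
       IsLca (leaf x) (leaf y') w' → w ⪯ w')

  IsTruncationMap : (Fin n → Bool → Fin m) → Set
  IsTruncationMap u = (∀ x s → leaf x ⪯ u x s) × (∀ x → u x (σ x) ≡ leaf x)

  QuasiBestMatch : (Fin n → Bool → Fin m) → Fin n → Fin n → Set
  QuasiBestMatch u x y = BestMatch x y ×
    (∀ w → IsLca (leaf x) (leaf y) w → w ⪯ u x (σ y))

Digraph : ℕ → Set₁
Digraph n = Fin n → Fin n → Set

Is2qBMG : ∀ {n} → Digraph n → Colouring n → Set
Is2qBMG {n} G σ = Σ (PhyloTree n) λ P →
  Σ (Fin n → Bool → Fin (PhyloTree.m P)) λ u →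
    IsTruncationMap P σ u × (∀ x y → G x y ⇔ QuasiBestMatch P σ u x y)

Graph : ℕ → Set₁
Graph n = Fin n → Fin n → Set

underlying : ∀ {n} → Digraph n → Graph n
underlying G x y = G x y ⊎ G y x

P6adj : Fin 6 → Fin 6 → Set
P6adj i j = suc (toℕ i) ≡ toℕ j ⊎ suc (toℕ j) ≡ toℕ i

C6adj : Fin 6 → Fin 6 → Set
C6adj i j = P6adj i j ⊎ ((toℕ i ≡ 0 × toℕ j ≡ 5) ⊎ (toℕ i ≡ 5 × toℕ j ≡ 0))

InducedCopy : ∀ {k n} → (Fin k → Fin k → Set) → Graph n → Set
InducedCopy {k} {n} H G = Σ (Fin k → Fin n) λ f →
  Injective _≡_ _≡_ f × (∀ i j → G (f i) (f j) ⇔ H i j)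

_Free : ∀ {k n} → (Fin k → Fin k → Set) → Graph n → Set
(H Free) G = ¬ InducedCopy H G

-- Quasi-best-match digraphs satisfy (N1)-(N3).  In the underlying graph of
-- such a digraph take six vertices v₀ ─ v₁ ─ ⋯ ─ v₅ forming a path whose
-- pairs at distance three are non-adjacent; induced copies of P₆ and of C₆
-- both give one.  On any four consecutive vertices, (N1) and (N2) forbid two
-- consecutive forward arcs followed by any arc, and any arc followed by two
-- consecutive backward arcs.  This forces the three middle edges to be
-- single arcs of alternating direction, the outer edges then extend the
-- alternation, and the resulting pattern ← → ← → (two vertices with a common
-- out-neighbour whose remaining out-neighbours lie at distance three) is
-- excluded by (N3).
module Submission where

open import Defs
open import Data.Nat using (ℕ; zero; suc; _+_; _∸_; _≤_; _<_)
open import Data.Nat.Induction using (<-rec)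
open import Data.Nat.Properties using (m∸n+n≡m; ≤-<-connex; <⇒≤)
open import Data.Fin using (Fin)
open import Data.Fin.Patterns using (0F; 1F; 2F; 3F; 4F; 5F)
open import Data.Bool using (Bool)
open import Data.Bool.Properties using (¬-not)
open import Data.Product using (∃; ∃-syntax; _×_; _,_)
open import Data.Sum using (_⊎_; inj₁; inj₂; [_,_]′)
open import Data.Empty using (⊥; ⊥-elim)
open import Relation.Nullary using (¬_)
open import Relation.Binary.PropositionalEquality
  using (_≡_; _≢_; refl; sym; trans; cong; subst; ≢-sym)
open import Function.Bundles using (_⇔_; Equivalence)
open Equivalence using (to; from)

¬¬-least : (P : ℕ → Set) {j : ℕ} → P j →
           ¬ ¬ (∃[ k ] P k × (∀ {l} → l < k → ¬ P l))
¬¬-least P pj no-least = <-rec (λ k → ¬ P k) (λ k below pk → no-least (k , pk , below)) _ pj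

iter-+ : ∀ {A : Set} (f : A → A) k l a → iter f (k + l) a ≡ iter f k (iter f l a)
iter-+ f zero    l a = refl
iter-+ f (suc k) l a = cong f (iter-+ f k l a)

≢-≢⇒≡ : ∀ {a b c : Bool} → a ≢ b → b ≢ c → a ≡ c
≢-≢⇒≡ a≢b b≢c = trans (¬-not a≢b) (sym (¬-not (≢-sym b≢c)))

module AncestorOrder {m : ℕ} (T : RootedTree m) where
  open RootedTree T

  ⪯-trans : ∀ {a b c} → a ⪯ b → b ⪯ c → a ⪯ c
  ⪯-trans {a} (k , refl) (l , refl) = l + k , iter-+ parent l k a

  iter-⪯ : ∀ v {k l} → k ≤ l → iter parent k v ⪯ iter parent l v
  iter-⪯ v {k} {l} k≤l =
    l ∸ k , trans (sym (iter-+ parent (l ∸ k) k v)) (cong (λ i → iter parent i v) (m∸n+n≡m k≤l))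

  ancestors-comparable : ∀ {v a b} → v ⪯ a → v ⪯ b → a ⪯ b ⊎ b ⪯ a
  ancestors-comparable {v} (k , refl) (l , refl) with ≤-<-connex k l
  ... | inj₁ k≤l = inj₁ (iter-⪯ v k≤l)
  ... | inj₂ l<k = inj₂ (iter-⪯ v (<⇒≤ l<k))

  lca-above₁ : ∀ {a b w} → IsLca a b w → a ⪯ w
  lca-above₁ ((a⪯w , _) , _) = a⪯w

  lca-above₂ : ∀ {a b w} → IsLca a b w → b ⪯ w
  lca-above₂ ((_ , b⪯w) , _) = b⪯w

  isLca-sym : ∀ {a b w} → IsLca a b w → IsLca b a w
  isLca-sym ((a⪯w , b⪯w) , least) = (b⪯w , a⪯w) , λ w' b⪯w' a⪯w' → least w' a⪯w' b⪯w'

  -- The lca of a and b is the lowest ancestor of a lying above b; one exists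
  -- because every vertex lies below the root.
  ¬¬-lca : ∀ a b → ¬ ¬ ∃ (IsLca a b)
  ¬¬-lca a b no-lca with reachRoot a | reachRoot b
  ... | j , a↑root | i , b↑root =
    ¬¬-least (λ k → b ⪯ iter parent k a) {j} (i , trans b↑root (sym a↑root)) λ where
      (k , b⪯w , lower-misses-b) →
        no-lca (iter parent k a , ((k , refl) , b⪯w) , λ where
          w' (l , refl) b⪯w' → [ iter-⪯ a , (λ l<k → ⊥-elim (lower-misses-b l<k b⪯w')) ]′
                                 (≤-<-connex k l))

-- (N1)-(N3), each stated as the impossibility of its counterexamples.
record QBMAxioms {V : Set} (R : V → V → Set) : Set where
  field
    n1 : ∀ {u t w v} → ¬ R u v → ¬ R v u → R u t → R v w → R t w → ⊥
    n2 : ∀ {u v w t} → R u v → R v w → R w t → ¬ R u t → ⊥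
    n3 : ∀ {a b z x y} → R a z → R b z → R a x → ¬ R b x → R b y → ¬ R a y → ⊥

QBMAxioms-⇔ : ∀ {V : Set} {R S : V → V → Set} →
              (∀ x y → R x y ⇔ S x y) → QBMAxioms S → QBMAxioms R
QBMAxioms-⇔ {R = R} {S} R⇔S ax = record
  { n1 = λ ¬ruv ¬rvu rut rvw rtw → n1 (¬S ¬ruv) (¬S ¬rvu) (S⇐ rut) (S⇐ rvw) (S⇐ rtw)
  ; n2 = λ ruv rvw rwt ¬rut → n2 (S⇐ ruv) (S⇐ rvw) (S⇐ rwt) (¬S ¬rut)
  ; n3 = λ raz rbz rax ¬rbx rby ¬ray →
      n3 (S⇐ raz) (S⇐ rbz) (S⇐ rax) (¬S ¬rbx) (S⇐ rby) (¬S ¬ray)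
  }
  where
  open QBMAxioms ax
  S⇐ : ∀ {x y} → R x y → S x y
  S⇐ = to (R⇔S _ _)
  ¬S : ∀ {x y} → ¬ R x y → ¬ S x y
  ¬S ¬r s = ¬r (from (R⇔S _ _) s)

module QuasiBestMatches {n : ℕ} (P : PhyloTree n) (σ : Colouring n)
                        (u : Fin n → Bool → Fin (PhyloTree.m P)) where
  open PhyloTree P
  open RootedTree tree
  open AncestorOrder tree

  private
    Q : Fin n → Fin n → Set
    Q = QuasiBestMatch P σ u

  qbm-colours : ∀ {x y} → Q x y → σ x ≢ σ y
  qbm-colours ((σx≢σy , _) , _) = σx≢σy

  qbm-lca-minimal : ∀ {x y z W W'} → Q x y → σ z ≡ σ y →
                    IsLca (leaf x) (leaf y) W → IsLca (leaf x) (leaf z) W' → W ⪯ W'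
  qbm-lca-minimal {z = z} ((_ , best) , _) σz≡σy lca-xy lca-xz = best z _ _ σz≡σy lca-xy lca-xz

  qbm-below-lca : ∀ {x y z W} → Q x y → σ z ≡ σ y →
                  IsLca (leaf x) (leaf y) W → leaf z ⪯ W → Q x z
  qbm-below-lca {x} {y} {z} {W} ((σx≢σy , best) , truncated) σz≡σy lca-xy z⪯W =
    ((λ σx≡σz → σx≢σy (trans σx≡σz σz≡σy)) , best') , truncated'
    where
    below-W : ∀ {w} → IsLca (leaf x) (leaf z) w → w ⪯ W
    below-W (_ , least) = least W (lca-above₁ lca-xy) z⪯W
    best' : ∀ y' w w' → σ y' ≡ σ z → IsLca (leaf x) (leaf z) w →
            IsLca (leaf x) (leaf y') w' → w ⪯ w'
    best' y' w w' σy'≡σz lca-xz lca-xy' =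
      ⪯-trans (below-W lca-xz) (best y' W w' (trans σy'≡σz σz≡σy) lca-xy lca-xy')
    truncated' : ∀ w → IsLca (leaf x) (leaf z) w → w ⪯ u x (σ z)
    truncated' w lca-xz =
      subst (λ s → w ⪯ u x s) (sym σz≡σy) (⪯-trans (below-W lca-xz) (truncated W lca-xy))

  qbm-⊆-of-lower-lca : ∀ {a b z x Wa Wb} → Q a z → Q b z →
                       IsLca (leaf a) (leaf z) Wa → IsLca (leaf b) (leaf z) Wb → Wa ⪯ Wb →
                       Q a x → ¬ ¬ Q b x
  qbm-⊆-of-lower-lca {a} {x = x} qaz qbz lca-az lca-bz Wa⪯Wb qax ¬qbx =
    ¬¬-lca (leaf a) (leaf x) λ (_ , lca-ax) →
    let σz≡σx = ≢-≢⇒≡ (≢-sym (qbm-colours qaz)) (qbm-colours qax)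
        Wx⪯Wa = qbm-lca-minimal qax σz≡σx lca-ax lca-az
    in ¬qbx (qbm-below-lca qbz (sym σz≡σx) lca-bz
               (⪯-trans (lca-above₂ lca-ax) (⪯-trans Wx⪯Wa Wa⪯Wb)))

  quasiBestMatch-axioms : QBMAxioms Q
  quasiBestMatch-axioms = record { n1 = n1 ; n2 = n2 ; n3 = n3 }
    where
    n1 : ∀ {a b c d} → ¬ Q a d → ¬ Q d a → Q a b → Q d c → Q b c → ⊥
    n1 {a} {b} {c} {d} ¬qad ¬qda qab qdc qbc =
      ¬¬-lca (leaf a) (leaf b) λ (_ , lca-ab) →
      ¬¬-lca (leaf b) (leaf c) λ (_ , lca-bc) →
      ¬¬-lca (leaf d) (leaf c) λ (_ , lca-dc) →
      let σa≡σc = ≢-≢⇒≡ (qbm-colours qab) (qbm-colours qbc)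
          σd≡σb = ≢-≢⇒≡ (qbm-colours qdc) (≢-sym (qbm-colours qbc))
          c⪯W₁  = ⪯-trans (lca-above₂ lca-bc)
                          (qbm-lca-minimal qbc σa≡σc lca-bc (isLca-sym lca-ab))
      in [ (λ W₃⪯W₁ → ¬qad (qbm-below-lca qab σd≡σb lca-ab (⪯-trans (lca-above₁ lca-dc) W₃⪯W₁)))
         , (λ W₁⪯W₃ → ¬qda (qbm-below-lca qdc σa≡σc lca-dc (⪯-trans (lca-above₁ lca-ab) W₁⪯W₃)))
         ]′ (ancestors-comparable (lca-above₂ lca-dc) c⪯W₁)

    n2 : ∀ {a b c d} → Q a b → Q b c → Q c d → ¬ Q a d → ⊥
    n2 {a} {b} {c} {d} qab qbc qcd ¬qad =
      ¬¬-lca (leaf a) (leaf b) λ (_ , lca-ab) →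
      ¬¬-lca (leaf b) (leaf c) λ (_ , lca-bc) →
      ¬¬-lca (leaf c) (leaf d) λ (_ , lca-cd) →
      let σa≡σc = ≢-≢⇒≡ (qbm-colours qab) (qbm-colours qbc)
          σd≡σb = ≢-≢⇒≡ (≢-sym (qbm-colours qcd)) (≢-sym (qbm-colours qbc))
          W₂⪯W₁ = qbm-lca-minimal qbc σa≡σc lca-bc (isLca-sym lca-ab)
          W₃⪯W₂ = qbm-lca-minimal qcd (sym σd≡σb) lca-cd (isLca-sym lca-bc)
      in ¬qad (qbm-below-lca qab σd≡σb lca-ab
                 (⪯-trans (lca-above₂ lca-cd) (⪯-trans W₃⪯W₂ W₂⪯W₁)))

    n3 : ∀ {a b z x y} → Q a z → Q b z → Q a x → ¬ Q b x → Q b y → ¬ Q a y → ⊥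
    n3 {a} {b} {z} qaz qbz qax ¬qbx qby ¬qay =
      ¬¬-lca (leaf a) (leaf z) λ (_ , lca-az) →
      ¬¬-lca (leaf b) (leaf z) λ (_ , lca-bz) →
      [ (λ Wa⪯Wb → qbm-⊆-of-lower-lca qaz qbz lca-az lca-bz Wa⪯Wb qax ¬qbx)
      , (λ Wb⪯Wa → qbm-⊆-of-lower-lca qbz qaz lca-bz lca-az Wb⪯Wa qby ¬qay)
      ]′ (ancestors-comparable (lca-above₂ lca-az) (lca-above₂ lca-bz))

module ChordlessPaths {V : Set} {R : V → V → Set} (ax : QBMAxioms R) where
  open QBMAxioms ax

  infix 4 _~_
  _~_ : V → V → Set
  x ~ y = R x y ⊎ R y x

  private
    ¬R : ∀ {x y} → ¬ x ~ y → ¬ R x y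
    ¬R x≁y r = x≁y (inj₁ r)

    ¬R⁻ : ∀ {x y} → ¬ x ~ y → ¬ R y x
    ¬R⁻ x≁y r = x≁y (inj₂ r)

  no-forward-forward : ∀ {a b c d} → R a b → R b c → c ~ d → ¬ a ~ d → ⊥
  no-forward-forward rab rbc (inj₁ rcd) a≁d = n2 rab rbc rcd (¬R a≁d)
  no-forward-forward rab rbc (inj₂ rdc) a≁d = n1 (¬R a≁d) (¬R⁻ a≁d) rab rdc rbc

  no-backward-backward : ∀ {a b c d} → a ~ b → R c b → R d c → ¬ a ~ d → ⊥
  no-backward-backward (inj₁ rab) rcb rdc a≁d = n1 (¬R⁻ a≁d) (¬R a≁d) rdc rab rcb
  no-backward-backward (inj₂ rba) rcb rdc a≁d = n2 rdc rcb rba (¬R⁻ a≁d)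

  forward⇒backward-before : ∀ {a b c d} → a ~ b → R b c → c ~ d → ¬ a ~ d → R b a
  forward⇒backward-before (inj₁ rab) rbc c~d a≁d = ⊥-elim (no-forward-forward rab rbc c~d a≁d)
  forward⇒backward-before (inj₂ rba) _   _   _   = rba

  forward⇒backward-after : ∀ {a b c d} → R a b → b ~ c → c ~ d → ¬ a ~ d → R c b
  forward⇒backward-after rab (inj₁ rbc) c~d a≁d = ⊥-elim (no-forward-forward rab rbc c~d a≁d)
  forward⇒backward-after rab (inj₂ rcb) _   _   = rcb

  backward⇒forward-before : ∀ {a b c d} → a ~ b → b ~ c → R d c → ¬ a ~ d → R b c
  backward⇒forward-before _   (inj₁ rbc) _   _   = rbc
  backward⇒forward-before a~b (inj₂ rcb) rdc a≁d = ⊥-elim (no-backward-backward a~b rcb rdc a≁d)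

  backward⇒forward-after : ∀ {a b c d} → a ~ b → R c b → c ~ d → ¬ a ~ d → R c d
  backward⇒forward-after _   _   (inj₁ rcd) _   = rcd
  backward⇒forward-after a~b rcb (inj₂ rdc) a≁d = ⊥-elim (no-backward-backward a~b rcb rdc a≁d)

  no-alternating : ∀ {x a z b y} → R a x → R a z → R b z → R b y → ¬ x ~ b → ¬ a ~ y → ⊥
  no-alternating rax raz rbz rby x≁b a≁y = n3 raz rbz rax (¬R⁻ x≁b) rby (¬R a≁y)

  no-chordless-path₆ : ∀ {v₀ v₁ v₂ v₃ v₄ v₅ : V} →
    v₀ ~ v₁ → v₁ ~ v₂ → v₂ ~ v₃ → v₃ ~ v₄ → v₄ ~ v₅ →
    ¬ v₀ ~ v₃ → ¬ v₁ ~ v₄ → ¬ v₂ ~ v₅ → ⊥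
  no-chordless-path₆ {v₀} {v₁} {v₂} {v₃} {v₄} {v₅} e₀₁ e₁₂ (inj₁ r₂₃) e₃₄ e₄₅ ¬e₀₃ ¬e₁₄ ¬e₂₅ =
    no-alternating r₂₁ r₂₃ r₄₃ r₄₅ ¬e₁₄ ¬e₂₅
    where
    r₂₁ : R v₂ v₁
    r₂₁ = forward⇒backward-before e₁₂ r₂₃ e₃₄ ¬e₁₄
    r₄₃ : R v₄ v₃
    r₄₃ = forward⇒backward-after r₂₃ e₃₄ e₄₅ ¬e₂₅
    r₄₅ : R v₄ v₅
    r₄₅ = backward⇒forward-after (inj₁ r₂₃) r₄₃ e₄₅ ¬e₂₅
  no-chordless-path₆ {v₀} {v₁} {v₂} {v₃} {v₄} {v₅} e₀₁ e₁₂ (inj₂ r₃₂) e₃₄ e₄₅ ¬e₀₃ ¬e₁₄ ¬e₂₅ =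
    no-alternating r₁₀ r₁₂ r₃₂ r₃₄ ¬e₀₃ ¬e₁₄
    where
    r₁₂ : R v₁ v₂
    r₁₂ = backward⇒forward-before e₀₁ e₁₂ r₃₂ ¬e₀₃
    r₃₄ : R v₃ v₄
    r₃₄ = backward⇒forward-after e₁₂ r₃₂ e₃₄ ¬e₁₄
    r₁₀ : R v₁ v₀
    r₁₀ = forward⇒backward-before e₀₁ r₁₂ (inj₂ r₃₂) ¬e₀₃

record ChordlessPath₆ (H : Fin 6 → Fin 6 → Set) : Set where
  field
    edge₀₁ : H 0F 1F
    edge₁₂ : H 1F 2F
    edge₂₃ : H 2F 3F
    edge₃₄ : H 3F 4F
    edge₄₅ : H 4F 5F
    no-chord₀₃ : ¬ H 0F 3F
    no-chord₁₄ : ¬ H 1F 4F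
    no-chord₂₅ : ¬ H 2F 5F

P6-chordless : ChordlessPath₆ P6adj
P6-chordless = record
  { edge₀₁ = inj₁ refl ; edge₁₂ = inj₁ refl ; edge₂₃ = inj₁ refl
  ; edge₃₄ = inj₁ refl ; edge₄₅ = inj₁ refl
  ; no-chord₀₃ = λ { (inj₁ ()) ; (inj₂ ()) }
  ; no-chord₁₄ = λ { (inj₁ ()) ; (inj₂ ()) }
  ; no-chord₂₅ = λ { (inj₁ ()) ; (inj₂ ()) }
  }

C6-chordless : ChordlessPath₆ C6adj
C6-chordless = record
  { edge₀₁ = inj₁ (inj₁ refl) ; edge₁₂ = inj₁ (inj₁ refl) ; edge₂₃ = inj₁ (inj₁ refl)
  ; edge₃₄ = inj₁ (inj₁ refl) ; edge₄₅ = inj₁ (inj₁ refl)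
  ; no-chord₀₃ = λ { (inj₁ p6) → no-chord₀₃ p6 ; (inj₂ (inj₁ (_ , ()))) ; (inj₂ (inj₂ (() , _))) }
  ; no-chord₁₄ = λ { (inj₁ p6) → no-chord₁₄ p6 ; (inj₂ (inj₁ (() , _))) ; (inj₂ (inj₂ (() , _))) }
  ; no-chord₂₅ = λ { (inj₁ p6) → no-chord₂₅ p6 ; (inj₂ (inj₁ (() , _))) ; (inj₂ (inj₂ (() , _))) }
  }
  where open ChordlessPath₆ P6-chordless

chordless-path₆-free : ∀ {n} {G : Digraph n} {H : Fin 6 → Fin 6 → Set} →
                       QBMAxioms G → ChordlessPath₆ H → (H Free) (underlying G)
chordless-path₆-free {H = H} ax path (f , _ , G~⇔H) =
  no-chordless-path₆ (edge edge₀₁) (edge edge₁₂) (edge edge₂₃) (edge edge₃₄) (edge edge₄₅)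
                     (non-edge no-chord₀₃) (non-edge no-chord₁₄) (non-edge no-chord₂₅)
  where
  open ChordlessPaths ax
  open ChordlessPath₆ path
  edge : ∀ {i j} → H i j → f i ~ f j
  edge = from (G~⇔H _ _)
  non-edge : ∀ {i j} → ¬ H i j → ¬ f i ~ f j
  non-edge ¬h e = ¬h (to (G~⇔H _ _) e)

-- (N1)-(N3) hold for every choice of u.
theorem3p2 : ∀ (n : ℕ) (G : Digraph n) (σ : Colouring n) → Is2qBMG G σ →
    (P6adj Free) (underlying G) × (C6adj Free) (underlying G)
theorem3p2 n G σ (P , u , _ , G⇔Q) =
  chordless-path₆-free G-axioms P6-chordless , chordless-path₆-free G-axioms C6-chordless
  where
  G-axioms : QBMAxioms G
  G-axioms = QBMAxioms-⇔ G⇔Q (QuasiBestMatches.quasiBestMatch-axioms P σ u)
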